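{- Let $n\ge1$. The map $f:\mathrm{P}_n\to\Lambda(\mathbb{F}_2^{n-1})$ defined by $f(\pi)=\bigvee_{a\in A(\pi)} f_{\mathcal{E}}(a)$, where $A(\pi)$ is any spanning forest of $\pi$, is a well-defined, injective, order-preserving and rank-preserving map.
   Context: $\mathrm{P}_n$ is the lattice of set partitions of $\{1,\ldots,n\}$ ordered by refinement, with rank $\operatorname{rk}(\pi)=n-\#\pi$ ($\#\pi$ the number of blocks). $\Lambda(\mathbb{F}_2^{n-1})$ is the lattice of subspaces of $\mathbb{F}_2^{n-1}$ ordered by inclusion, join being the sum of subspaces and rank the dimension. $\mathcal{E}$ is the set of edges $(i,j)$, $1\le i<j\le n$; $f_{\mathcal{E}}(i,j)=\langle e_i+e_j\rangle$ if $j<n$ and $f_{\mathcal{E}}(i,n)=\langle e_i\rangle$, where $e_1,\ldots,e_{n-1}$ is the standard basis. An edge $(i,j)$ is an edge of $\pi$ if $i,j$ lie in a common block. A spanning forest of $\pi$ is a set of edges of $\pi$ forming a forest (no cycles) on the vertex set $\{1,\ldots,n\}$ whose connected components have as vertex sets exactly the blocks of $\pi$ (i.e. its join in $\mathrm{P}_n$ is $\pi$). -}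

module Defs where

open import Data.Bool using (Bool; true; false; _xor_; _∧_; not; if_then_else_)
open import Data.Nat using (ℕ; zero; suc; _∸_; _≤_; _<ᵇ_)
open import Data.Fin using (Fin; toℕ; inject₁; _<_)
import Data.Fin as Fin
open import Data.Vec using (Vec; []; _∷_; replicate; zipWith; tabulate)
open import Data.List using (List; []; _∷_; length; _++_; [_]; map; foldr; allFin)
open import Data.Bool.ListAction using (any)
open import Data.Nat.ListAction using (sum)
open import Data.List.Relation.Unary.Any using (Any)
open import Data.List.Relation.Unary.All using (All)
open import Data.List.Relation.Unary.Linked using (Linked)
open import Data.List.Relation.Unary.Unique.Propositional using (Unique)
open import Data.Product using (Σ; ∃; ∃₂; _×_; _,_; proj₁; proj₂)
open import Data.Sum using (_⊎_)
open import Relation.Binary.PropositionalEquality using (_≡_)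
open import Relation.Binary.Construct.Closure.ReflexiveTransitive using (Star)
open import Relation.Nullary using (¬_; does)

-- The field F₂ = Bool (xor = addition), the vector space F₂^m = Vec Bool m

_⊕_ : ∀ {m} → Vec Bool m → Vec Bool m → Vec Bool m
_⊕_ = zipWith _xor_

𝟎 : ∀ {m} → Vec Bool m
𝟎 = replicate _ false

e : ∀ {m} → Fin m → Vec Bool m
e i = tabulate (λ l → does (i Fin.≟ l))

-- ê k for a vertex k ∈ Fin (suc m):  ê (inject₁ i) = e_i, and ê (last) = 0
-- (the last vertex plays the role of the vertex n of the paper)
ê : ∀ {m} → Fin (suc m) → Vec Bool m
ê k = tabulate (λ l → does (k Fin.≟ inject₁ l))

lincomb : ∀ {m d} → Vec Bool d → Vec (Vec Bool m) d → Vec Bool m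
lincomb [] [] = 𝟎
lincomb (c ∷ cs) (b ∷ bs) = (if c then b else 𝟎) ⊕ lincomb cs bs

Sub : ℕ → Set₁
Sub m = Vec Bool m → Set

_⊆_ : ∀ {m} → Sub m → Sub m → Set
W ⊆ U = ∀ x → W x → U x

_≐_ : ∀ {m} → Sub m → Sub m → Set
W ≐ U = W ⊆ U × U ⊆ W

⊥ˢ : ∀ {m} → Sub m
⊥ˢ x = x ≡ 𝟎

⟨_⟩ : ∀ {m} → Vec Bool m → Sub m
⟨ v ⟩ x = x ≡ 𝟎 ⊎ x ≡ v

_∨_ : ∀ {m} → Sub m → Sub m → Sub m
(W ∨ U) x = ∃₂ λ w u → W w × U u × x ≡ w ⊕ u

InSpan : ∀ {m d} → Vec (Vec Bool m) d → Sub m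
InSpan b x = ∃ λ c → x ≡ lincomb c b

LinIndep : ∀ {m d} → Vec (Vec Bool m) d → Set
LinIndep {d = d} b = ∀ c → lincomb c b ≡ 𝟎 → c ≡ replicate d false

HasDim : ∀ {m} → Sub m → ℕ → Set
HasDim {m} W d = Σ (Vec (Vec Bool m) d) λ b →
  LinIndep b × (∀ x → (W x → InSpan b x) × (InSpan b x → W x))

-- Set partitions of Fin n, as (decidable) equivalence relations

record Partition (n : ℕ) : Set where
  field
    R     : Fin n → Fin n → Bool
    refl  : ∀ i → R i i ≡ true
    sym   : ∀ i j → R i j ≡ true → R j i ≡ true
    trans : ∀ i j k → R i j ≡ true → R j k ≡ true → R i k ≡ true
open Partition public

_≤ᴾ_ : ∀ {n} → Partition n → Partition n → Set
π ≤ᴾ σ = ∀ i j → R π i j ≡ true → R σ i j ≡ true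

_≈ᴾ_ : ∀ {n} → Partition n → Partition n → Set
π ≈ᴾ σ = ∀ i j → R π i j ≡ R σ i j

isMinOfBlock : ∀ {n} → Partition n → Fin n → Bool
isMinOfBlock {n} π i = not (any (λ j → (toℕ j <ᵇ toℕ i) ∧ R π j i) (allFin n))

-- number of blocks #π (one least element per block)
#blocks : ∀ {n} → Partition n → ℕ
#blocks {n} π = sum (map (λ i → if isMinOfBlock π i then 1 else 0) (allFin n))

rk : ∀ {n} → Partition n → ℕ
rk {n} π = n ∸ #blocks π

Edge : ℕ → Set
Edge n = Σ (Fin n × Fin n) λ p → proj₁ p < proj₂ p

src tgt : ∀ {n} → Edge n → Fin n
src ((i , _) , _) = i
tgt ((_ , j) , _) = j

Adj : ∀ {n} → List (Edge n) → Fin n → Fin n → Set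
Adj A x y = Any (λ a → (src a ≡ x × tgt a ≡ y) ⊎ (src a ≡ y × tgt a ≡ x)) A

HasCycle : ∀ {n} → List (Edge n) → Set
HasCycle {n} A = Σ (Fin n) λ v → Σ (List (Fin n)) λ vs →
  2 ≤ length vs × Unique (v ∷ vs) × Linked (Adj A) ((v ∷ vs) ++ [ v ])

Forest : ∀ {n} → List (Edge n) → Set
Forest A = ¬ HasCycle A

SpanningForest : ∀ {n} → Partition n → List (Edge n) → Set
SpanningForest {n} π A =
  All (λ a → R π (src a) (tgt a) ≡ true) A ×
  Forest A ×
  (∀ i j → (Star (Adj A) i j → R π i j ≡ true) × (R π i j ≡ true → Star (Adj A) i j))

-- f_E and the join over a spanning forest  (here n = suc m)

fE : ∀ {m} → Edge (suc m) → Sub m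
fE a = ⟨ ê (src a) ⊕ ê (tgt a) ⟩

⋁fE : ∀ {m} → List (Edge (suc m)) → Sub m
⋁fE A = foldr (λ a W → fE a ∨ W) ⊥ˢ A

-- Write n = suc m; vertex n is `fromℕ m`, and ê sends it to 0 and every other
-- vertex k to eₖ.  For a relation P on vertices, Gen P is the subspace spanned
-- by the vectors ê i ⊕ ê j with P i j.
--  (1) The join over an edge list A is Gen (Adj A), and Gen P only depends on
--      the connectivity of P, because ê i ⊕ ê j telescopes along a path.  For
--      a spanning forest A of π the connectivity of A is the block relation ~
--      of π, so f(π) = Gen (~): well defined and monotone.
--  (2) For a 2-colouring F of the vertices the linear functional `cut F`
--      satisfies cut F (ê a ⊕ ê b) = F a xor F b, so it vanishes on Gen P when
--      F is constant along P.  Colouring by "lies in the block of i" shows that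
--      ê i ⊕ ê j ∈ f(π) forces i ~ j; hence f reflects the order: injective.
--  (3) Let leader i be the least element of the block of i.  The edges
--      (leader j , j) form a spanning forest of π (existence), and the vectors
--      ê (leader j) ⊕ ê j for the non-leaders j form a basis of f(π): they span,
--      and the colouring by j is a dual functional for them.  There are n minus
--      the number of blocks of them, which is the rank.
module Submission where

open import Defs hiding (refl; sym; trans)

open import Algebra.Bundles using (CommutativeRing)
open import Data.Bool using (Bool; true; false; _xor_; _∧_; not; if_then_else_; T)
import Data.Bool as Bool
open import Data.Bool.ListAction using (any)
open import Data.Bool.Properties
  using (xor-assoc; xor-comm; xor-identityˡ; xor-identityʳ; xor-same; ∧-distribʳ-xor;
         xor-annihilates-not; xor-∧-commutativeRing; T-≡; T-∧; ¬-not; not-injective)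
open import Data.Empty using (⊥; ⊥-elim)
open import Data.Fin using (Fin; zero; suc; toℕ; inject₁; fromℕ; _≟_; inject; fromℕ<)
open import Data.Fin.Base using (Fin′)
import Data.Fin.Properties as Finₚ
open import Data.List using (List; []; _∷_; _++_; [_]; map; allFin; length)
open import Data.List.Membership.Propositional using (_∈_; lose)
open import Data.List.Membership.Propositional.Properties using (∈-allFin)
open import Data.List.Properties using (length-tabulate)
import Data.List.Relation.Unary.All as All
open import Data.List.Relation.Unary.All using (All; []; _∷_)
open import Data.List.Relation.Unary.AllPairs using (_∷_)
import Data.List.Relation.Unary.Any as Any
open import Data.List.Relation.Unary.Any using (here; there)
open import Data.List.Relation.Unary.Any.Properties using (any⁺)
open import Data.List.Relation.Unary.Linked using (Linked; _∷_)
open import Data.List.Relation.Unary.Unique.Propositional using (Unique)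
open import Data.List.Relation.Unary.Unique.Propositional.Properties using (allFin⁺)
open import Data.Nat using (ℕ; zero; suc; _+_; _∸_; _<ᵇ_; s≤s) renaming (_<_ to _<ℕ_; _≤_ to _≤ℕ_)
import Data.Nat.Properties as ℕₚ
open import Data.Nat.ListAction using (sum)
open import Data.Product using (∃; _×_; _,_; proj₁; proj₂)
open import Data.Sum using (_⊎_; inj₁; inj₂)
open import Data.Vec using (Vec; []; _∷_; tabulate)
open import Data.Vec.Relation.Binary.Pointwise.Inductive
  using (Pointwise-≡⇒≡; zipWith-assoc; zipWith-comm; zipWith-identityˡ; zipWith-identityʳ)
open import Data.Vec.Relation.Unary.All using ([]; _∷_) renaming (All to AllV)
open import Function using (_∘_; Equivalence)
open import Relation.Binary.Construct.Closure.ReflexiveTransitive using (Star; ε; _◅_; _◅◅_; reverse)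
open import Relation.Binary.PropositionalEquality
  using (_≡_; _≢_; refl; sym; trans; cong; cong₂; subst; module ≡-Reasoning)
open import Relation.Nullary using (¬_; does; yes; no)
open import Relation.Nullary.Decidable using (dec-true; dec-false)

open import Algebra.Properties.CommutativeSemigroup
  (CommutativeRing.+-commutativeSemigroup xor-∧-commutativeRing)
  using () renaming (interchange to xor-interchange)

open Equivalence using (to; from)

xor-cancelˡ : ∀ c a b → (c xor a) xor (c xor b) ≡ a xor b
xor-cancelˡ false a b = refl
xor-cancelˡ true  a b = xor-annihilates-not a b

true≢false : true ≢ false
true≢false ()

true-ext : ∀ {x y : Bool} → (x ≡ true → y ≡ true) → (y ≡ true → x ≡ true) → x ≡ y
true-ext {true}  {_}     x⇒y _   = sym (x⇒y refl)
true-ext {false} {true}  _   y⇒x = y⇒x refl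
true-ext {false} {false} _   _   = refl

any-false : ∀ {A : Set} (p : A → Bool) (xs : List A) → (∀ x → ¬ T (p x)) → any p xs ≡ false
any-false p []       _       = refl
any-false p (x ∷ xs) ¬passes with p x in px
... | true  = ⊥-elim (¬passes x (from T-≡ px))
... | false = any-false p xs ¬passes

⊕-assoc : ∀ {m} (x y z : Vec Bool m) → (x ⊕ y) ⊕ z ≡ x ⊕ (y ⊕ z)
⊕-assoc x y z = Pointwise-≡⇒≡ (zipWith-assoc xor-assoc x y z)

⊕-comm : ∀ {m} (x y : Vec Bool m) → x ⊕ y ≡ y ⊕ x
⊕-comm x y = Pointwise-≡⇒≡ (zipWith-comm xor-comm x y)

⊕-identityˡ : ∀ {m} (x : Vec Bool m) → 𝟎 ⊕ x ≡ x
⊕-identityˡ x = Pointwise-≡⇒≡ (zipWith-identityˡ xor-identityˡ x)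

⊕-identityʳ : ∀ {m} (x : Vec Bool m) → x ⊕ 𝟎 ≡ x
⊕-identityʳ x = Pointwise-≡⇒≡ (zipWith-identityʳ xor-identityʳ x)

⊕-self : ∀ {m} (x : Vec Bool m) → x ⊕ x ≡ 𝟎
⊕-self []      = refl
⊕-self (a ∷ x) = cong₂ _∷_ (xor-same a) (⊕-self x)

⊕-interchange : ∀ {m} (a b c d : Vec Bool m) → (a ⊕ b) ⊕ (c ⊕ d) ≡ (a ⊕ c) ⊕ (b ⊕ d)
⊕-interchange []       []       []       []       = refl
⊕-interchange (a ∷ as) (b ∷ bs) (c ∷ cs) (d ∷ ds) =
  cong₂ _∷_ (xor-interchange a b c d) (⊕-interchange as bs cs ds)

⊕-cancel : ∀ {m} (a b c : Vec Bool m) → (a ⊕ b) ⊕ (a ⊕ c) ≡ b ⊕ c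
⊕-cancel a b c = begin
  (a ⊕ b) ⊕ (a ⊕ c) ≡⟨ ⊕-interchange a b a c ⟩
  (a ⊕ a) ⊕ (b ⊕ c) ≡⟨ cong (_⊕ (b ⊕ c)) (⊕-self a) ⟩
  𝟎 ⊕ (b ⊕ c)       ≡⟨ ⊕-identityˡ (b ⊕ c) ⟩
  b ⊕ c             ∎
  where open ≡-Reasoning

⊕-telescope : ∀ {m} (a b c : Vec Bool m) → (a ⊕ b) ⊕ (b ⊕ c) ≡ a ⊕ c
⊕-telescope a b c = trans (cong (_⊕ (b ⊕ c)) (⊕-comm a b)) (⊕-cancel b a c)

⊕≡𝟎⇒≡ : ∀ {m} (x y : Vec Bool m) → x ⊕ y ≡ 𝟎 → x ≡ y
⊕≡𝟎⇒≡ x y x⊕y≡𝟎 = begin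
  x                 ≡⟨ sym (⊕-identityʳ x) ⟩
  x ⊕ 𝟎             ≡⟨ cong (_⊕ 𝟎) (sym (⊕-identityʳ x)) ⟩
  (x ⊕ 𝟎) ⊕ 𝟎       ≡⟨ cong ((x ⊕ 𝟎) ⊕_) (sym x⊕y≡𝟎) ⟩
  (x ⊕ 𝟎) ⊕ (x ⊕ y) ≡⟨ ⊕-cancel x 𝟎 y ⟩
  𝟎 ⊕ y             ≡⟨ ⊕-identityˡ y ⟩
  y                 ∎
  where open ≡-Reasoning

⊆-trans : ∀ {m} {U V W : Sub m} → U ⊆ V → V ⊆ W → U ⊆ W
⊆-trans U⊆V V⊆W x = V⊆W x ∘ U⊆V x

≐-sym : ∀ {m} {U V : Sub m} → U ≐ V → V ≐ U
≐-sym (U⊆V , V⊆U) = V⊆U , U⊆V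

≐-trans : ∀ {m} {U V W : Sub m} → U ≐ V → V ≐ W → U ≐ W
≐-trans (U⊆V , V⊆U) (V⊆W , W⊆V) = ⊆-trans U⊆V V⊆W , ⊆-trans W⊆V V⊆U

-- over F₂ a subspace is a subset containing 0 and closed under addition
record IsSubspace {m} (W : Sub m) : Set where
  field
    𝟎∈ : W 𝟎
    ⊕∈ : ∀ {x y} → W x → W y → W (x ⊕ y)
open IsSubspace

scale-xor : ∀ {m} (c d : Bool) (b : Vec Bool m) →
  (if c xor d then b else 𝟎) ≡ (if c then b else 𝟎) ⊕ (if d then b else 𝟎)
scale-xor true  true  b = sym (⊕-self b)
scale-xor true  false b = sym (⊕-identityʳ b)
scale-xor false d     b = sym (⊕-identityˡ _)

lincomb-⊕ : ∀ {m d} (c c′ : Vec Bool d) (b : Vec (Vec Bool m) d) →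
  lincomb (c ⊕ c′) b ≡ lincomb c b ⊕ lincomb c′ b
lincomb-⊕ []       []         []       = sym (⊕-identityˡ 𝟎)
lincomb-⊕ (c ∷ cs) (c′ ∷ cs′) (b ∷ bs) =
  trans (cong₂ _⊕_ (scale-xor c c′ b) (lincomb-⊕ cs cs′ bs))
        (⊕-interchange _ _ (lincomb cs bs) (lincomb cs′ bs))

lincomb-𝟎 : ∀ {m d} (b : Vec (Vec Bool m) d) → lincomb 𝟎 b ≡ 𝟎
lincomb-𝟎 []       = refl
lincomb-𝟎 (b ∷ bs) = trans (⊕-identityˡ _) (lincomb-𝟎 bs)

InSpan-subspace : ∀ {m d} (b : Vec (Vec Bool m) d) → IsSubspace (InSpan b)
InSpan-subspace b = record
  { 𝟎∈ = 𝟎 , sym (lincomb-𝟎 b)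
  ; ⊕∈ = λ { (c , refl) (c′ , refl) → c ⊕ c′ , sym (lincomb-⊕ c c′ b) } }

InSpan-least : ∀ {m d} {W : Sub m} → IsSubspace W →
  (b : Vec (Vec Bool m) d) → AllV W b → InSpan b ⊆ W
InSpan-least W-sub []       []          _ ([] , refl)      = 𝟎∈ W-sub
InSpan-least {W = W} W-sub (b ∷ bs) (b∈W ∷ bs∈W) _ (c ∷ cs , refl) =
  ⊕∈ W-sub (scaled c) (InSpan-least W-sub bs bs∈W _ (cs , refl))
  where
  scaled : ∀ c → W (if c then b else 𝟎)
  scaled true  = b∈W
  scaled false = 𝟎∈ W-sub

InSpan-∷ : ∀ {m d} (x : Vec Bool m) (xs : Vec (Vec Bool m) d) → InSpan xs ⊆ InSpan (x ∷ xs)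
InSpan-∷ x xs y (c , y≡) = false ∷ c , trans y≡ (sym (⊕-identityˡ _))

InSpan-head : ∀ {m d} (x : Vec Bool m) (xs : Vec (Vec Bool m) d) → InSpan (x ∷ xs) x
InSpan-head x xs = true ∷ 𝟎 , sym (trans (cong (x ⊕_) (lincomb-𝟎 xs)) (⊕-identityʳ x))

LinIndep-[] : ∀ {m} → LinIndep {m} []
LinIndep-[] [] _ = refl

LinIndep-∷ : ∀ {m d} (x : Vec Bool m) (xs : Vec (Vec Bool m) d) →
  LinIndep xs → ¬ InSpan xs x → LinIndep (x ∷ xs)
LinIndep-∷ x xs indep x∉ (true  ∷ cs) ≡𝟎 = ⊥-elim (x∉ (cs , ⊕≡𝟎⇒≡ x _ ≡𝟎))
LinIndep-∷ x xs indep x∉ (false ∷ cs) ≡𝟎 =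
  cong (false ∷_) (indep cs (trans (sym (⊕-identityˡ _)) ≡𝟎))

HasDim-≐ : ∀ {m} {W U : Sub m} {d} → HasDim W d → W ≐ U → HasDim U d
HasDim-≐ (b , indep , basis) (W⊆U , U⊆W) =
  b , indep , λ x → proj₁ (basis x) ∘ U⊆W x , W⊆U x ∘ proj₂ (basis x)

-- Linear functionals; the cut functional of a 2-colouring of the vertices.

dot : ∀ {m} → (Fin m → Bool) → Vec Bool m → Bool
dot g []       = false
dot g (x ∷ xs) = (x ∧ g zero) xor dot (g ∘ suc) xs

dot-𝟎 : ∀ {m} (g : Fin m → Bool) → dot g 𝟎 ≡ false
dot-𝟎 {zero}  g = refl
dot-𝟎 {suc m} g = dot-𝟎 (g ∘ suc)

dot-⊕ : ∀ {m} (g : Fin m → Bool) (x y : Vec Bool m) → dot g (x ⊕ y) ≡ dot g x xor dot g y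
dot-⊕ g []      []      = refl
dot-⊕ g (a ∷ x) (b ∷ y) =
  trans (cong₂ _xor_ (∧-distribʳ-xor (g zero) a b) (dot-⊕ (g ∘ suc) x y))
        (xor-interchange (a ∧ g zero) (b ∧ g zero) _ _)

ker-subspace : ∀ {m} (g : Fin m → Bool) → IsSubspace (λ x → dot g x ≡ false)
ker-subspace g = record
  { 𝟎∈ = dot-𝟎 g
  ; ⊕∈ = λ {x} {y} gx gy → trans (dot-⊕ g x y) (cong₂ _xor_ gx gy) }

zeros-tabulate : ∀ {m} → tabulate {n = m} (λ _ → false) ≡ 𝟎
zeros-tabulate {zero}  = refl
zeros-tabulate {suc m} = cong (false ∷_) zeros-tabulate

dot-ê : ∀ {m} (G : Fin (suc m) → Bool) → G (fromℕ m) ≡ false →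
  ∀ a → dot (G ∘ inject₁) (ê a) ≡ G a
dot-ê {zero}  G G-last zero    = sym G-last
dot-ê {suc m} G G-last zero    =
  trans (cong (G zero xor_) (trans (cong (dot g) zeros-tabulate) (dot-𝟎 g))) (xor-identityʳ (G zero))
  where
  g : Fin m → Bool
  g = G ∘ inject₁ ∘ suc
dot-ê {suc m} G G-last (suc a) = dot-ê (G ∘ suc) G-last a

cut : ∀ {m} → (Fin (suc m) → Bool) → Vec Bool m → Bool
cut {m} F = dot (λ l → F (fromℕ m) xor F (inject₁ l))

cut-edge : ∀ {m} (F : Fin (suc m) → Bool) a b → cut F (ê a ⊕ ê b) ≡ F a xor F b
cut-edge {m} F a b = begin
  cut F (ê a ⊕ ê b)             ≡⟨ dot-⊕ _ (ê a) (ê b) ⟩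
  cut F (ê a) xor cut F (ê b)   ≡⟨ cong₂ _xor_ (dot-ê G G-last a) (dot-ê G G-last b) ⟩
  (F n xor F a) xor (F n xor F b) ≡⟨ xor-cancelˡ (F n) (F a) (F b) ⟩
  F a xor F b                   ∎
  where
  open ≡-Reasoning
  n : Fin (suc m)
  n = fromℕ m
  G : Fin (suc m) → Bool
  G a = F n xor F a
  G-last : G n ≡ false
  G-last = xor-same (F n)

VRel : ℕ → Set₁
VRel m = Fin (suc m) → Fin (suc m) → Set

data Gen {m} (P : VRel m) : Vec Bool m → Set where
  gen-zero : Gen P 𝟎
  gen-add  : ∀ {i j y} → P i j → Gen P y → Gen P ((ê i ⊕ ê j) ⊕ y)

Gen-subspace : ∀ {m} (P : VRel m) → IsSubspace (Gen P)
Gen-subspace P = record { 𝟎∈ = gen-zero ; ⊕∈ = add }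
  where
  add : ∀ {x y} → Gen P x → Gen P y → Gen P (x ⊕ y)
  add gen-zero         gy = subst (Gen P) (sym (⊕-identityˡ _)) gy
  add (gen-add {i} {j} {z} p gz) gy =
    subst (Gen P) (sym (⊕-assoc (ê i ⊕ ê j) z _)) (gen-add p (add gz gy))

Gen-least : ∀ {m} {P : VRel m} {W : Sub m} → IsSubspace W →
  (∀ {i j} → P i j → W (ê i ⊕ ê j)) → Gen P ⊆ W
Gen-least W-sub gens _ gen-zero      = 𝟎∈ W-sub
Gen-least W-sub gens _ (gen-add p g) = ⊕∈ W-sub (gens p) (Gen-least W-sub gens _ g)

Gen-gen : ∀ {m} {P : VRel m} {i j} → P i j → Gen P (ê i ⊕ ê j)
Gen-gen p = subst (Gen _) (⊕-identityʳ _) (gen-add p gen-zero)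

Gen-⊆ : ∀ {m} {P Q : VRel m} → (∀ {i j} → P i j → Gen Q (ê i ⊕ ê j)) → Gen P ⊆ Gen Q
Gen-⊆ {Q = Q} = Gen-least (Gen-subspace Q)

-- the generator of two connected vertices telescopes along a path
Gen-star : ∀ {m} {P : VRel m} {i j} → Star P i j → Gen P (ê i ⊕ ê j)
Gen-star {i = i} ε = subst (Gen _) (sym (⊕-self (ê i))) gen-zero
Gen-star (p ◅ path) = subst (Gen _) (⊕-telescope _ _ _) (gen-add p (Gen-star path))

cut-Gen : ∀ {m} {P : VRel m} (F : Fin (suc m) → Bool) →
  (∀ {a b} → P a b → F a ≡ F b) → Gen P ⊆ (λ x → cut F x ≡ false)
cut-Gen F F-const = Gen-least (ker-subspace _)
  (λ {a} {b} p → trans (cut-edge F a b) (trans (cong (_xor F b) (F-const p)) (xor-same (F b))))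

line-subspace : ∀ {m} (v : Vec Bool m) → IsSubspace ⟨ v ⟩
line-subspace v = record { 𝟎∈ = inj₁ refl ; ⊕∈ = add }
  where
  add : ∀ {x y} → ⟨ v ⟩ x → ⟨ v ⟩ y → ⟨ v ⟩ (x ⊕ y)
  add (inj₁ refl) y∈          = subst ⟨ v ⟩ (sym (⊕-identityˡ _)) y∈
  add (inj₂ refl) (inj₁ refl) = inj₂ (⊕-identityʳ v)
  add (inj₂ refl) (inj₂ refl) = inj₁ (⊕-self v)

∨-subspace : ∀ {m} {V W : Sub m} → IsSubspace V → IsSubspace W → IsSubspace (V ∨ W)
∨-subspace V-sub W-sub = record
  { 𝟎∈ = 𝟎 , 𝟎 , 𝟎∈ V-sub , 𝟎∈ W-sub , sym (⊕-identityˡ 𝟎)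
  ; ⊕∈ = λ { (v₁ , w₁ , v₁∈ , w₁∈ , refl) (v₂ , w₂ , v₂∈ , w₂∈ , refl) →
             v₁ ⊕ v₂ , w₁ ⊕ w₂ , ⊕∈ V-sub v₁∈ v₂∈ , ⊕∈ W-sub w₁∈ w₂∈ ,
             ⊕-interchange v₁ w₁ v₂ w₂ } }

⋁fE-subspace : ∀ {m} (A : List (Edge (suc m))) → IsSubspace (⋁fE A)
⋁fE-subspace []      = record { 𝟎∈ = refl ; ⊕∈ = λ { refl refl → ⊕-identityˡ 𝟎 } }
⋁fE-subspace (a ∷ A) = ∨-subspace (line-subspace _) (⋁fE-subspace A)

⋁fE-edge : ∀ {m} (A : List (Edge (suc m))) {i j} → Adj A i j → ⋁fE A (ê i ⊕ ê j)
⋁fE-edge (a ∷ A) (here (inj₁ (refl , refl))) =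
  _ , 𝟎 , inj₂ refl , 𝟎∈ (⋁fE-subspace A) , sym (⊕-identityʳ _)
⋁fE-edge (a ∷ A) (here (inj₂ (refl , refl))) =
  _ , 𝟎 , inj₂ refl , 𝟎∈ (⋁fE-subspace A) , trans (⊕-comm _ _) (sym (⊕-identityʳ _))
⋁fE-edge (a ∷ A) (there adj) = 𝟎 , _ , inj₁ refl , ⋁fE-edge A adj , sym (⊕-identityˡ _)

⋁fE⊆Gen : ∀ {m} (A : List (Edge (suc m))) → ⋁fE A ⊆ Gen (Adj A)
⋁fE⊆Gen []      _ refl = gen-zero
⋁fE⊆Gen (a ∷ A) _ (w , u , w∈ , u∈ , refl) =
  ⊕∈ (Gen-subspace _) (edge w∈) (Gen-⊆ (Gen-gen ∘ there) u (⋁fE⊆Gen A u u∈))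
  where
  edge : ∀ {w} → fE a w → Gen (Adj (a ∷ A)) w
  edge (inj₁ refl) = gen-zero
  edge (inj₂ refl) = Gen-gen (here (inj₁ (refl , refl)))

⋁fE≐Gen : ∀ {m} (A : List (Edge (suc m))) → ⋁fE A ≐ Gen (Adj A)
⋁fE≐Gen A = ⋁fE⊆Gen A , Gen-least (⋁fE-subspace A) (⋁fE-edge A)

adj-sym : ∀ {m} {A : List (Edge (suc m))} {x y} → Adj A x y → Adj A y x
adj-sym = Any.map λ { (inj₁ e) → inj₂ e ; (inj₂ e) → inj₁ e }

-- Everything about a fixed partition π: its block relation ~, the leader
-- (least element) of each block, f(π) = Gen (~), the leader forest and a basis.

module Blocks {m : ℕ} (π : Partition (suc m)) where

  _~_ : VRel m
  i ~ j = R π i j ≡ true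

  ~-refl : ∀ i → i ~ i
  ~-refl = Partition.refl π

  ~-sym : ∀ {i j} → i ~ j → j ~ i
  ~-sym = Partition.sym π _ _

  ~-trans : ∀ {i j k} → i ~ j → j ~ k → i ~ k
  ~-trans = Partition.trans π _ _ _

  ~-resp : ∀ {a b} c → a ~ b → R π a c ≡ R π b c
  ~-resp c a~b = true-ext (~-trans (~-sym a~b)) (~-trans a~b)

  -- search for the least vertex of the block of i (i itself is a candidate)
  private
    leastInBlock : ∀ i →
      ∃ λ k → ¬ (R π k i ≡ false) × ((j : Fin′ k) → R π (inject j) i ≡ false)
    leastInBlock i = Finₚ.¬∀⟶∃¬-smallest (suc m) (λ k → R π k i ≡ false)
      (λ k → R π k i Bool.≟ false) (λ all-false → true≢false (trans (sym (~-refl i)) (all-false i)))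

  leader : Fin (suc m) → Fin (suc m)
  leader i = proj₁ (leastInBlock i)

  leader-~ : ∀ i → leader i ~ i
  leader-~ i = ¬-not (proj₁ (proj₂ (leastInBlock i)))

  below-leader : ∀ {k i} → toℕ k <ℕ toℕ (leader i) → R π k i ≡ false
  below-leader {k} {i} k<l =
    subst (λ z → R π z i ≡ false) inject-k≡k (proj₂ (proj₂ (leastInBlock i)) (fromℕ< k<l))
    where
    inject-k≡k : inject (fromℕ< k<l) ≡ k
    inject-k≡k = Finₚ.toℕ-injective (trans (Finₚ.toℕ-inject (fromℕ< k<l)) (Finₚ.toℕ-fromℕ< k<l))

  leader-least : ∀ {k i} → k ~ i → toℕ (leader i) ≤ℕ toℕ k
  leader-least k~i = ℕₚ.≮⇒≥ (λ k<l → true≢false (trans (sym k~i) (below-leader k<l)))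

  leader-cong : ∀ {i j} → i ~ j → leader i ≡ leader j
  leader-cong {i} {j} i~j = Finₚ.toℕ-injective (ℕₚ.≤-antisym
    (leader-least (~-trans (leader-~ j) (~-sym i~j)))
    (leader-least (~-trans (leader-~ i) i~j)))

  leader-idem : ∀ i → leader (leader i) ≡ leader i
  leader-idem i = leader-cong (leader-~ i)

  -- a non-leader is numbered above its leader, so leader edges are edges
  leader-< : ∀ {j} → leader j ≢ j → toℕ (leader j) <ℕ toℕ j
  leader-< {j} nr = ℕₚ.≤∧≢⇒< (leader-least (~-refl j)) (nr ∘ Finₚ.toℕ-injective)

  isMin-spec : ∀ i → isMinOfBlock π i ≡ does (leader i ≟ i)
  isMin-spec i with leader i ≟ i
  ... | yes leader≡i = cong not (any-false _ (allFin (suc m)) no-smaller)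
    where
    no-smaller : ∀ k → ¬ T ((toℕ k <ᵇ toℕ i) ∧ R π k i)
    no-smaller k passes with to T-∧ passes
    ... | k<i , k~i = ℕₚ.<-irrefl (cong toℕ leader≡i)
          (ℕₚ.≤-<-trans (leader-least (to T-≡ k~i)) (ℕₚ.<ᵇ⇒< _ _ k<i))
  ... | no nr = cong not (to T-≡ (any⁺ _ (lose (∈-allFin (leader i)) leader-passes)))
    where
    leader-passes : T ((toℕ (leader i) <ᵇ toℕ i) ∧ R π (leader i) i)
    leader-passes = from T-∧ (ℕₚ.<⇒<ᵇ (leader-< nr) , from T-≡ (leader-~ i))

  blockSpace : Sub m
  blockSpace = Gen _~_

  blockSpace-edge : ∀ {i j} → blockSpace (ê i ⊕ ê j) → i ~ j
  blockSpace-edge {i} {j} t = ~-sym (not-injective (begin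
    not (R π j i)           ≡⟨ cong (_xor R π j i) (sym (~-refl i)) ⟩
    R π i i xor R π j i     ≡⟨ sym (cut-edge F i j) ⟩
    cut F (ê i ⊕ ê j)       ≡⟨ cut-Gen F (~-resp i) _ t ⟩
    false                   ∎))
    where
    open ≡-Reasoning
    F : Fin (suc m) → Bool
    F a = R π a i

  adj-~ : ∀ {A : List (Edge (suc m))} → All (λ a → src a ~ tgt a) A → ∀ {x y} → Adj A x y → x ~ y
  adj-~ (a∈π ∷ _)  (here (inj₁ (refl , refl))) = a∈π
  adj-~ (a∈π ∷ _)  (here (inj₂ (refl , refl))) = ~-sym a∈π
  adj-~ (_ ∷ A∈π) (there adj)                  = adj-~ A∈π adj

  spanningForest-≐ : ∀ {A} → SpanningForest π A → ⋁fE A ≐ blockSpace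
  spanningForest-≐ {A} (_ , _ , conn) = ≐-trans (⋁fE≐Gen A)
    ( Gen-⊆ (λ {i} {j} adj → Gen-gen (proj₁ (conn i j) (adj ◅ ε)))
    , Gen-⊆ (λ {i} {j} i~j → Gen-star (proj₂ (conn i j) i~j)) )

  LeaderOf : VRel m
  LeaderOf x y = leader y ≡ x × leader y ≢ y

  leaderEdges : List (Fin (suc m)) → List (Edge (suc m))
  leaderEdges []      = []
  leaderEdges (j ∷ L) with leader j ≟ j
  ... | yes _  = leaderEdges L
  ... | no nr = ((leader j , j) , leader-< nr) ∷ leaderEdges L

  leaderEdges-ok : ∀ L → All (λ a → LeaderOf (src a) (tgt a)) (leaderEdges L)
  leaderEdges-ok []      = []
  leaderEdges-ok (j ∷ L) with leader j ≟ j
  ... | yes _  = leaderEdges-ok L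
  ... | no nr = (refl , nr) ∷ leaderEdges-ok L

  leaderEdges-∋ : ∀ {j} L → j ∈ L → leader j ≢ j → Adj (leaderEdges L) (leader j) j
  leaderEdges-∋ (k ∷ L) j∈ nr with leader k ≟ k | j∈
  ... | yes _       | there j∈L = leaderEdges-∋ L j∈L nr
  ... | yes root    | here refl = ⊥-elim (nr root)
  ... | no _        | there j∈L = there (leaderEdges-∋ L j∈L nr)
  ... | no _        | here refl = here (inj₁ (refl , refl))

  leaderForest : List (Edge (suc m))
  leaderForest = leaderEdges (allFin (suc m))

  adj-leader : ∀ {x y} → Adj leaderForest x y → LeaderOf x y ⊎ LeaderOf y x
  adj-leader = go (leaderEdges-ok _)
    where
    go : ∀ {A x y} → All (λ a → LeaderOf (src a) (tgt a)) A → Adj A x y →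
         LeaderOf x y ⊎ LeaderOf y x
    go (ok ∷ _)  (here (inj₁ (refl , refl))) = inj₁ ok
    go (ok ∷ _)  (here (inj₂ (refl , refl))) = inj₂ ok
    go (_ ∷ oks) (there adj)                  = go oks adj

  neighbour-of-nonleader : ∀ {a b} → Adj leaderForest a b → leader b ≢ b → a ≡ leader b
  neighbour-of-nonleader {a} {b} ab nr with adj-leader ab
  ... | inj₁ (leader-b≡a , _) = sym leader-b≡a
  ... | inj₂ (leader-a≡b , _) =
    ⊥-elim (nr (trans (cong leader (sym leader-a≡b)) (trans (leader-idem a) leader-a≡b)))

  through-nonleader : ∀ {a b c} → Adj leaderForest a b → Adj leaderForest b c → leader b ≢ b → a ≡ c
  through-nonleader ab bc nr =
    trans (neighbour-of-nonleader ab nr) (sym (neighbour-of-nonleader (adj-sym bc) nr))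

  nonleader-endpoint : ∀ {a b} → Adj leaderForest a b → leader a ≢ a ⊎ leader b ≢ b
  nonleader-endpoint ab with adj-leader ab
  ... | inj₁ (_ , nr) = inj₂ nr
  ... | inj₂ (_ , nr) = inj₁ nr

  -- on a cycle v, v₁, v₂, … one of v₁, v₂ is a non-leader, whose two cycle
  -- neighbours would have to coincide
  leaderForest-acyclic : Forest leaderForest
  leaderForest-acyclic (v , []     , () , _)
  leaderForest-acyclic (v , _ ∷ [] , s≤s () , _)
  leaderForest-acyclic (v , v₁ ∷ v₂ ∷ r , _ , (v≢v₁ ∷ v≢v₂ ∷ _) ∷ (_ ∷ v₁∉r) ∷ _ , a₀₁ ∷ a₁₂ ∷ path)
    with nonleader-endpoint a₁₂
  ... | inj₁ nr₁ = v≢v₂ (through-nonleader a₀₁ a₁₂ nr₁)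
  ... | inj₂ nr₂ = successor-is-v₁ r v₁∉r path
    where
    successor-is-v₁ : ∀ r → All (v₁ ≢_) r → Linked (Adj leaderForest) (v₂ ∷ r ++ [ v ]) → ⊥
    successor-is-v₁ []      []          (a₂₃ ∷ _) = v≢v₁ (sym (through-nonleader a₁₂ a₂₃ nr₂))
    successor-is-v₁ (_ ∷ _) (v₁≢x ∷ _) (a₂₃ ∷ _) = v₁≢x (through-nonleader a₁₂ a₂₃ nr₂)

  toLeader : ∀ x → Star (Adj leaderForest) (leader x) x
  toLeader x with leader x ≟ x
  ... | yes root = subst (λ z → Star _ z x) (sym root) ε
  ... | no nr   = leaderEdges-∋ (allFin (suc m)) (∈-allFin x) nr ◅ ε

  leaderForest-spanning : SpanningForest π leaderForest
  leaderForest-spanning = in-blocks , leaderForest-acyclic , λ i j → star-~ , ~-star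
    where
    in-blocks : All (λ a → src a ~ tgt a) leaderForest
    in-blocks = All.map (λ (leader≡ , _) → subst (_~ _) leader≡ (leader-~ _)) (leaderEdges-ok _)
    star-~ : ∀ {i j} → Star (Adj leaderForest) i j → i ~ j
    star-~ {i} ε          = ~-refl i
    star-~ (adj ◅ path) = ~-trans (adj-~ in-blocks adj) (star-~ path)
    ~-star : ∀ {i j} → i ~ j → Star (Adj leaderForest) i j
    ~-star {i} {j} i~j = reverse adj-sym (toLeader i)
      ◅◅ subst (λ z → Star _ z j) (sym (leader-cong i~j)) (toLeader j)

  -- the vector of the edge (leader i , i); zero when i is a leader
  leaderVec : Fin (suc m) → Vec Bool m
  leaderVec i = ê (leader i) ⊕ ê i

  leaderVec-⊕ : ∀ {i j} → i ~ j → leaderVec i ⊕ leaderVec j ≡ ê i ⊕ ê j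
  leaderVec-⊕ {i} {j} i~j =
    trans (cong (λ z → leaderVec i ⊕ (ê z ⊕ ê j)) (sym (leader-cong i~j)))
          (⊕-cancel (ê (leader i)) (ê i) (ê j))

  -- colouring a non-leader j alone is a dual functional: it sees leaderVec j only
  leaderVec-dual : ∀ {j} → leader j ≢ j → ∀ i →
    cut (λ a → does (a ≟ j)) (leaderVec i) ≡ does (i ≟ j)
  leaderVec-dual {j} nr i =
    trans (cut-edge (λ a → does (a ≟ j)) (leader i) i)
          (cong (_xor does (i ≟ j)) (dec-false (leader i ≟ j) leader-i≢j))
    where
    leader-i≢j : leader i ≢ j
    leader-i≢j leader-i≡j =
      nr (trans (cong leader (sym leader-i≡j)) (trans (leader-idem i) leader-i≡j))

  #nonLeaders : List (Fin (suc m)) → ℕ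
  #nonLeaders []      = 0
  #nonLeaders (j ∷ L) with leader j ≟ j
  ... | yes _ = #nonLeaders L
  ... | no _  = suc (#nonLeaders L)

  basis : (L : List (Fin (suc m))) → Vec (Vec Bool m) (#nonLeaders L)
  basis []      = []
  basis (j ∷ L) with leader j ≟ j
  ... | yes _ = basis L
  ... | no _  = leaderVec j ∷ basis L

  basis-All : ∀ {W : Sub m} L → All (W ∘ leaderVec) L → AllV W (basis L)
  basis-All []      []       = []
  basis-All (j ∷ L) (w ∷ ws) with leader j ≟ j
  ... | yes _ = basis-All L ws
  ... | no _  = w ∷ basis-All L ws

  leaderVec∈basis : ∀ {i} L → i ∈ L → InSpan (basis L) (leaderVec i)
  leaderVec∈basis (j ∷ L) i∈ with leader j ≟ j | i∈
  ... | yes _    | there i∈L = leaderVec∈basis L i∈L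
  ... | no _     | there i∈L = InSpan-∷ _ (basis L) _ (leaderVec∈basis L i∈L)
  ... | no _     | here refl = InSpan-head _ (basis L)
  ... | yes root | here refl = subst (InSpan (basis L))
        (sym (trans (cong (λ z → ê z ⊕ ê j) root) (⊕-self (ê j)))) (𝟎∈ (InSpan-subspace (basis L)))

  -- for duplicate-free L the basis is independent, by the dual functionals
  basis-indep : ∀ L → Unique L → LinIndep (basis L)
  basis-indep []      _            = LinIndep-[]
  basis-indep (j ∷ L) (j∉L ∷ uniq) with leader j ≟ j
  ... | yes _ = basis-indep L uniq
  ... | no nr = LinIndep-∷ (leaderVec j) (basis L) (basis-indep L uniq) outside
    where
    φ : Vec Bool m → Bool
    φ = cut (λ a → does (a ≟ j))
    φ-kills-basis : InSpan (basis L) ⊆ (λ x → φ x ≡ false)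
    φ-kills-basis = InSpan-least (ker-subspace _) (basis L) (basis-All L
      (All.map (λ j≢i → trans (leaderVec-dual nr _) (dec-false (_ ≟ j) (j≢i ∘ sym))) j∉L))
    outside : ¬ InSpan (basis L) (leaderVec j)
    outside j∈span = true≢false (begin
      true                   ≡⟨ sym (dec-true (j ≟ j) refl) ⟩
      does (j ≟ j)           ≡⟨ sym (leaderVec-dual nr j) ⟩
      φ (leaderVec j)        ≡⟨ φ-kills-basis _ j∈span ⟩
      false                  ∎)
      where open ≡-Reasoning

  leaderIndicator : Fin (suc m) → ℕ
  leaderIndicator i = if isMinOfBlock π i then 1 else 0

  #nonLeaders-count : ∀ L → #nonLeaders L + sum (map leaderIndicator L) ≡ length L
  #nonLeaders-count []      = refl
  #nonLeaders-count (j ∷ L) rewrite isMin-spec j with leader j ≟ j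
  ... | yes _ = trans (ℕₚ.+-suc (#nonLeaders L) _) (cong suc (#nonLeaders-count L))
  ... | no _  = cong suc (#nonLeaders-count L)

  rank-#nonLeaders : rk π ≡ #nonLeaders (allFin (suc m))
  rank-#nonLeaders = begin
    suc m ∸ #blocks π              ≡⟨ cong (_∸ #blocks π) (sym (length-tabulate (λ i → i))) ⟩
    length all ∸ #blocks π         ≡⟨ cong (_∸ #blocks π) (sym (#nonLeaders-count all)) ⟩
    (#nonLeaders all + #blocks π) ∸ #blocks π ≡⟨ ℕₚ.m+n∸n≡m (#nonLeaders all) (#blocks π) ⟩
    #nonLeaders all                ∎
    where
    open ≡-Reasoning
    all : List (Fin (suc m))
    all = allFin (suc m)

  blockSpace-dim : HasDim blockSpace (rk π)
  blockSpace-dim = subst (HasDim blockSpace) (sym rank-#nonLeaders)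
    (basis all , basis-indep all (allFin⁺ (suc m)) , λ x → spans x , within x)
    where
    all : List (Fin (suc m))
    all = allFin (suc m)
    spans : blockSpace ⊆ InSpan (basis all)
    spans = Gen-least (InSpan-subspace (basis all)) λ {i} {j} i~j →
      subst (InSpan (basis all)) (leaderVec-⊕ i~j)
        (⊕∈ (InSpan-subspace (basis all))
            (leaderVec∈basis all (∈-allFin i)) (leaderVec∈basis all (∈-allFin j)))
    within : InSpan (basis all) ⊆ blockSpace
    within = InSpan-least (Gen-subspace _) (basis all)
      (basis-All all (All.tabulate (λ {i} _ → Gen-gen (leader-~ i))))

open Blocks using (blockSpace; blockSpace-edge; spanningForest-≐)

blockSpace-mono : ∀ {m} (π σ : Partition (suc m)) → π ≤ᴾ σ → blockSpace π ⊆ blockSpace σ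
blockSpace-mono π σ π≤σ = Gen-⊆ (λ {i} {j} i~j → Gen-gen (π≤σ i j i~j))

blockSpace-reflects : ∀ {m} (π σ : Partition (suc m)) → blockSpace π ⊆ blockSpace σ → π ≤ᴾ σ
blockSpace-reflects π σ incl i j i~j = blockSpace-edge σ (incl _ (Gen-gen i~j))

≤ᴾ-antisym : ∀ {m} (π σ : Partition (suc m)) → π ≤ᴾ σ → σ ≤ᴾ π → π ≈ᴾ σ
≤ᴾ-antisym π σ π≤σ σ≤π i j = true-ext (π≤σ i j) (σ≤π i j)

f-well-defined : ∀ {m} (π : Partition (suc m)) (A B : List (Edge (suc m))) →
  SpanningForest π A → SpanningForest π B → ⋁fE A ≐ ⋁fE B
f-well-defined π A B A-sf B-sf = ≐-trans (spanningForest-≐ π A-sf) (≐-sym (spanningForest-≐ π B-sf))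

f-injective : ∀ {m} (π σ : Partition (suc m)) (A B : List (Edge (suc m))) →
  SpanningForest π A → SpanningForest σ B → ⋁fE A ≐ ⋁fE B → π ≈ᴾ σ
f-injective π σ A B A-sf B-sf A≐B =
  ≤ᴾ-antisym π σ (blockSpace-reflects π σ (proj₁ fπ≐fσ)) (blockSpace-reflects σ π (proj₂ fπ≐fσ))
  where
  fπ≐fσ : blockSpace π ≐ blockSpace σ
  fπ≐fσ = ≐-trans (≐-sym (spanningForest-≐ π A-sf)) (≐-trans A≐B (spanningForest-≐ σ B-sf))

f-monotone : ∀ {m} (π σ : Partition (suc m)) (A B : List (Edge (suc m))) →
  SpanningForest π A → SpanningForest σ B → π ≤ᴾ σ → ⋁fE A ⊆ ⋁fE B
f-monotone π σ A B A-sf B-sf π≤σ =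
  ⊆-trans (proj₁ (spanningForest-≐ π A-sf))
    (⊆-trans (blockSpace-mono π σ π≤σ) (proj₂ (spanningForest-≐ σ B-sf)))

f-rank : ∀ {m} (π : Partition (suc m)) (A : List (Edge (suc m))) →
  SpanningForest π A → HasDim (⋁fE A) (rk π)
f-rank π A A-sf = HasDim-≐ (Blocks.blockSpace-dim π) (≐-sym (spanningForest-≐ π A-sf))

mainTheorem15 : (m : ℕ) →
      (∀ (π : Partition (suc m)) → ∃ λ A → SpanningForest π A)
    × (∀ (π : Partition (suc m)) (A B : List (Edge (suc m))) →
         SpanningForest π A → SpanningForest π B → ⋁fE A ≐ ⋁fE B)
    × (∀ (π σ : Partition (suc m)) (A B : List (Edge (suc m))) →
         SpanningForest π A → SpanningForest σ B → ⋁fE A ≐ ⋁fE B → π ≈ᴾ σ)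
    × (∀ (π σ : Partition (suc m)) (A B : List (Edge (suc m))) →
         SpanningForest π A → SpanningForest σ B → π ≤ᴾ σ → ⋁fE A ⊆ ⋁fE B)
    × (∀ (π : Partition (suc m)) (A : List (Edge (suc m))) →
         SpanningForest π A → HasDim (⋁fE A) (rk π))
mainTheorem15 m =
  (λ π → Blocks.leaderForest π , Blocks.leaderForest-spanning π) ,
  f-well-defined , f-injective , f-monotone , f-rank
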